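{- Let $\Pi_1 = (\mathcal{A}, \mathcal{R}_1)$ and $\Pi_2 = (\mathcal{A}, \mathcal{R}_2)$ be two logic programs, and let $\Pi_1' = (\mathcal{A}, \emptyset, \mathcal{R}_1)$ and $\Pi'_2 = (\mathcal{A}, \emptyset, \mathcal{R}_2)$ be the ELPs with the same sets of rules and no epistemic literals. Then $\Pi_1$ and $\Pi_2$ are strongly equivalent (as logic programs) if and only if $\Pi_1'$ and $\Pi_2'$ are strongly equivalent (as ELPs).
   Context: A logic program is a pair $(\mathcal{A},\mathcal{R})$ of a set of atoms and rules $a_1\vee\cdots\vee a_l\leftarrow a_{l+1},\ldots,a_m,\neg\ell_1,\ldots,\neg\ell_n$, $\ell_i$ literals (atoms $a$ or $\neg a$). Interpretations are $I\subseteq\mathcal{A}$, with $I\models a$ iff $a\in I$ and $I\models\neg\varphi$ iff $I\not\models\varphi$; $I$ is a model of a rule if, whenever $I$ satisfies all body elements, $I$ contains some head atom. The GL-reduct $\Pi^I$ consists of $\mathrm{head}(r)\leftarrow\mathrm{pbody}(r)$ (positive body $\{a_{l+1},\dots,a_m\}$) for the rules $r$ with $I\models\neg\ell$ for all $\neg\ell$ in the body. $M$ is an answer set if $M$ is a model of $\Pi$ and no $M'\subsetneq M$ is a model of $\Pi^M$. Two logic programs over the same atoms are strongly equivalent iff for every logic program $\Pi=(\mathcal{A},\mathcal{R})$, $(\mathcal{A},\mathcal{R}_1\cup\mathcal{R})$ and $(\mathcal{A},\mathcal{R}_2\cup\mathcal{R})$ have the same answer sets. An ELP is $(\mathcal{A},\mathcal{E},\mathcal{R})$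 with $\mathcal{E}$ a set of epistemic literals $\mathbf{not}\,\ell$ over $\mathcal{A}$ and rules $a_1\vee\cdots\vee a_k\leftarrow\ell_1,\ldots,\ell_m,\xi_1,\ldots,\xi_j,\neg\xi_{j+1},\ldots,\neg\xi_n$, $\xi_i\in\mathcal{E}$; union is componentwise. For a guess $\Phi\subseteq\mathcal{E}$, a set $\mathcal{I}$ of interpretations is $\Phi$-compatible w.r.t. $\mathcal{E}$ iff $\mathcal{I}\neq\emptyset$, each $\mathbf{not}\,\ell\in\Phi$ has some $I\in\mathcal{I}$ with $I\not\models\ell$, and each $\mathbf{not}\,\ell\in\mathcal{E}\setminus\Phi$ has $I\models\ell$ for all $I\in\mathcal{I}$. The epistemic reduct $\Pi^\Phi$ replaces each $\mathbf{not}\,\ell\in\Phi$ by $\top$ and every remaining $\mathbf{not}$ by $\neg$ ($\neg\neg\neg a$ treated as $\neg a$). A candidate world view (CWV) with associated guess $\Phi$ is a set $\mathcal{M}$ equal to the set of answer sets of $\Pi^\Phi$ that is $\Phi$-compatible w.r.t. $\mathcal{E}$; a world view (WV) is a CWV whose associated guess is subset-maximal among associated guesses of CWVs. Two ELPs $\Pi_1',\Pi_2'$ are strongly equivalent iff for every ELP $\Pi$, $\Pi_1'\cup\Pi$ and $\Pi_2'\cup\Pi$ have the same world views. -}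

module Defs where

open import Data.Nat using (ℕ)
open import Data.Fin using (Fin)
import Data.Fin as Fin
open import Data.Fin.Subset using (Subset; _∈_; _∉_; _⊂_)
open import Data.Fin.Subset.Properties using (_∈?_)
open import Data.List using (List; []; _∷_; _++_; map; filter)
open import Data.List.Relation.Unary.All using (All; all?)
open import Data.List.Relation.Unary.Any using (Any; any?)
import Data.List.Membership.Propositional as LMem
import Data.List.Membership.DecPropositional as LDecMem
open import Data.List.Relation.Binary.Subset.Propositional using () renaming (_⊆_ to _⊆ᴸ_)
open import Data.Product using (_×_; ∃; ∃-syntax; Σ-syntax)
open import Relation.Nullary using (¬_; Dec; yes; no; ¬?)
open import Relation.Binary.Definitions using (DecidableEquality)
open import Relation.Binary.PropositionalEquality using (_≡_; refl; cong)
open import Function.Bundles using (_⇔_)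

-- Atoms: the finite set 𝒜 = Fin n.  Interpretations I ⊆ 𝒜: Subset n.

data Lit (n : ℕ) : Set where
  pos : Fin n → Lit n
  neg : Fin n → Lit n

_⊨_ : ∀ {n} → Subset n → Lit n → Set
I ⊨ pos a = a ∈ I
I ⊨ neg a = a ∉ I

_⊨?_ : ∀ {n} (I : Subset n) (ℓ : Lit n) → Dec (I ⊨ ℓ)
I ⊨? pos a = a ∈? I
I ⊨? neg a = ¬? (a ∈? I)

-- complement of a literal (used for ¬¬a and ¬¬¬a = ¬a)
compl : ∀ {n} → Lit n → Lit n
compl (pos a) = neg a
compl (neg a) = pos a

pos-inj : ∀ {n} {a b : Fin n} → pos a ≡ pos b → a ≡ b
pos-inj refl = refl

neg-inj : ∀ {n} {a b : Fin n} → neg a ≡ neg b → a ≡ b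
neg-inj refl = refl

_≟ᴸ_ : ∀ {n} → DecidableEquality (Lit n)
pos a ≟ᴸ pos b with a Fin.≟ b
... | yes p = yes (cong pos p)
... | no ¬p = no (λ e → ¬p (pos-inj e))
pos a ≟ᴸ neg b = no (λ ())
neg a ≟ᴸ pos b = no (λ ())
neg a ≟ᴸ neg b with a Fin.≟ b
... | yes p = yes (cong neg p)
... | no ¬p = no (λ e → ¬p (neg-inj e))

module LitMem {n : ℕ} = LDecMem (_≟ᴸ_ {n})
open LitMem using () renaming (_∈_ to _∈ᴸ_; _∉_ to _∉ᴸ_; _∈?_ to _∈ᴸ?_)

-- a₁ ∨ … ∨ a_l ← a_{l+1},…,a_m, ¬ℓ₁,…,¬ℓ_n
-- head = [a₁..a_l], pbody = [a_{l+1}..a_m], nbody = [ℓ₁..ℓ_n]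
record Rule (n : ℕ) : Set where
  constructor rule
  field
    head  : List (Fin n)
    pbody : List (Fin n)
    nbody : List (Lit n)
open Rule public

-- A logic program (𝒜, ℛ) with 𝒜 = Fin n: its rule set ℛ.
LP : ℕ → Set
LP n = List (Rule n)

BodySat : ∀ {n} → Subset n → Rule n → Set
BodySat I r = All (_∈ I) (pbody r) × All (λ ℓ → ¬ (I ⊨ ℓ)) (nbody r)

ModelRule : ∀ {n} → Subset n → Rule n → Set
ModelRule I r = BodySat I r → Any (_∈ I) (head r)

ModelLP : ∀ {n} → Subset n → LP n → Set
ModelLP I R = All (ModelRule I) R

record PosRule (n : ℕ) : Set where
  constructor prule
  field
    phead : List (Fin n)
    ppbody : List (Fin n)
open PosRule public

ModelPosRule : ∀ {n} → Subset n → PosRule n → Set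
ModelPosRule I r = All (_∈ I) (ppbody r) → Any (_∈ I) (phead r)

ModelPos : ∀ {n} → Subset n → List (PosRule n) → Set
ModelPos I R = All (ModelPosRule I) R

NegOK : ∀ {n} → Subset n → Rule n → Set
NegOK I r = All (λ ℓ → ¬ (I ⊨ ℓ)) (nbody r)

NegOK? : ∀ {n} (I : Subset n) (r : Rule n) → Dec (NegOK I r)
NegOK? I r = all? (λ ℓ → ¬? (I ⊨? ℓ)) (nbody r)

GL : ∀ {n} → LP n → Subset n → List (PosRule n)
GL R I = map (λ r → prule (head r) (pbody r)) (filter (NegOK? I) R)

AnswerSet : ∀ {n} → LP n → Subset n → Set
AnswerSet R M = ModelLP M R × (∀ M' → M' ⊂ M → ¬ ModelPos M' (GL R M))

StronglyEquivLP : ∀ {n} → LP n → LP n → Set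
StronglyEquivLP {n} R₁ R₂ =
  ∀ (R : LP n) (M : Subset n) → AnswerSet (R₁ ++ R) M ⇔ AnswerSet (R₂ ++ R) M

-- An epistemic literal "not ℓ" is represented by its literal ℓ.
-- a₁ ∨ … ∨ a_k ← (objective body as in Rule), ξ₁,…,ξ_j, ¬ξ_{j+1},…,¬ξ_n
record ERule (n : ℕ) : Set where
  constructor erule
  field
    ehead  : List (Fin n)
    epbody : List (Fin n)
    enbody : List (Lit n)
    epos   : List (Lit n)   -- ξ = not ℓ occurring positively
    eneg   : List (Lit n)   -- ξ = not ℓ occurring under ¬
open ERule public

record ELP (n : ℕ) : Set where
  constructor elp
  field
    eps   : List (Lit n)     -- ℰ : the ℓ with not ℓ ∈ ℰ
    rules : List (ERule n)
open ELP public

WellFormed : ∀ {n} → ELP n → Set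
WellFormed Π = All (λ r → (epos r ⊆ᴸ eps Π) × (eneg r ⊆ᴸ eps Π)) (rules Π)

_∪ᴱ_ : ∀ {n} → ELP n → ELP n → ELP n
Π₁ ∪ᴱ Π₂ = elp (eps Π₁ ++ eps Π₂) (rules Π₁ ++ rules Π₂)

-- Epistemic reduct of a single rule w.r.t. guess Φ:
-- not ℓ ∈ Φ ↦ ⊤ ; remaining not ℓ ↦ ¬ℓ ; ¬(not ℓ) with not ℓ ∈ Φ is ¬⊤,
-- which makes the body unsatisfiable (rule dropped); ¬(not ℓ) with not ℓ ∉ Φ
-- is ¬¬ℓ, i.e. the body element ¬(compl ℓ) (¬¬a, resp. ¬¬¬a = ¬a).
ereduct : ∀ {n} → List (Lit n) → List (ERule n) → LP n
ereduct Φ [] = []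
ereduct Φ (r ∷ rs) with any? (_∈ᴸ? Φ) (eneg r)
... | yes _ = ereduct Φ rs
... | no _ = rule (ehead r) (epbody r)
                  (enbody r ++ filter (λ ℓ → ¬? (ℓ ∈ᴸ? Φ)) (epos r) ++ map compl (eneg r))
             ∷ ereduct Φ rs

Worlds : ℕ → Set₁
Worlds n = Subset n → Set

Compatible : ∀ {n} → List (Lit n) → List (Lit n) → Worlds n → Set
Compatible E Φ 𝓜 =
  (∃[ I ] 𝓜 I)
  × (∀ ℓ → ℓ ∈ᴸ Φ → ∃[ I ] (𝓜 I × ¬ (I ⊨ ℓ)))
  × (∀ ℓ → ℓ ∈ᴸ E → ℓ ∉ᴸ Φ → ∀ I → 𝓜 I → I ⊨ ℓ)

CWV : ∀ {n} → ELP n → List (Lit n) → Worlds n → Set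
CWV Π Φ 𝓜 =
  (Φ ⊆ᴸ eps Π)
  × (∀ I → 𝓜 I ⇔ AnswerSet (ereduct Φ (rules Π)) I)
  × Compatible (eps Π) Φ 𝓜

WV : ∀ {n} → ELP n → Worlds n → Set₁
WV {n} Π 𝓜 =
  Σ[ Φ ∈ List (Lit n) ] (CWV Π Φ 𝓜
    × (∀ (Φ' : List (Lit n)) (𝓜' : Worlds n) → CWV Π Φ' 𝓜' → Φ ⊆ᴸ Φ' → Φ' ⊆ᴸ Φ))

StronglyEquivELP : ∀ {n} → ELP n → ELP n → Set₁
StronglyEquivELP {n} Π₁ Π₂ =
  ∀ (Π : ELP n) → WellFormed Π →
    ∀ (𝓜 : Worlds n) → WV (Π₁ ∪ᴱ Π) 𝓜 ⇔ WV (Π₂ ∪ᴱ Π) 𝓜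

toERule : ∀ {n} → Rule n → ERule n
toERule r = erule (head r) (pbody r) (nbody r) [] []

toELP : ∀ {n} → LP n → ELP n
toELP R = elp [] (map toERule R)

module Submission where

-- The argument rests on one computation: the epistemic reduct leaves rules
-- without epistemic literals untouched, so for every guess Φ
--   ereduct Φ (lift R ++ X) = R ++ ereduct Φ X .                (reduct-lift-++)
--
-- (⇒) If R₁ and R₂ are strongly equivalent LPs, then for every ELP context
--     Π and guess Φ the reducts of Π₁' ∪ Π and Π₂' ∪ Π are R₁ and R₂ extended
--     by the same LP ereduct Φ Π, hence have the same answer sets.  Candidate
--     world views only depend on ℰ and on these answer sets, so both unions
--     have the same candidate world views with the same guesses, and
--     therefore the same world views (wv-transfer).
-- (⇐) Adding a plain LP context R to both sides, the ELP Rᵢ' ∪ R' is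
--     "objective": its reduct is Rᵢ ++ R for every guess.  For an objective
--     ELP with ℰ = ∅ the set of answer sets, when non-empty, is its world
--     view with guess ∅, and every world view consists of answer sets; so an
--     answer set of R₁ ++ R carries over to R₂ ++ R through the world views.

open import Defs
open import Data.Nat using (ℕ)
open import Data.List using (List; []; _∷_; _++_; map)
open import Data.List.Properties using (++-identityʳ)
open import Data.List.Relation.Unary.All using ([]; _∷_)
open import Data.Fin.Subset using (Subset)
open import Data.Product using (_,_)
open import Function.Bundles using (_⇔_; mk⇔; Equivalence)
import Function.Properties.Equivalence as ⇔
open import Relation.Binary.PropositionalEquality
  using (_≡_; refl; cong; cong₂; sym; module ≡-Reasoning)

private
  variable
    n : ℕ

lift : LP n → List (ERule n)
lift R = map toERule R

answerSets-≡ : {P Q : LP n} {I : Subset n} → P ≡ Q → AnswerSet P I ⇔ AnswerSet Q I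
answerSets-≡ refl = ⇔.refl

reduct-lift-++ : (Φ : List (Lit n)) (R : LP n) (X : List (ERule n)) →
                 ereduct Φ (lift R ++ X) ≡ R ++ ereduct Φ X
reduct-lift-++ Φ [] X = refl
reduct-lift-++ Φ (rule h p q ∷ R) X =
  cong₂ _∷_ (cong (rule h p) (++-identityʳ q)) (reduct-lift-++ Φ R X)

lift-wellFormed : (R : LP n) → WellFormed (toELP R)
lift-wellFormed [] = []
lift-wellFormed (r ∷ R) = ((λ ()) , (λ ())) ∷ lift-wellFormed R

-- Two ELP rule sets whose epistemic reducts have the same answer sets for
-- every guess.  (A record, so that X₁ and X₂ are recoverable from the type.)
record ReductEquiv (X₁ X₂ : List (ERule n)) : Set where
  constructor reductEquiv
  field
    sameAnswerSets : ∀ (Φ : List (Lit n)) (I : Subset n) →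
                     AnswerSet (ereduct Φ X₁) I ⇔ AnswerSet (ereduct Φ X₂) I
open ReductEquiv

ReductEquiv-sym : {X₁ X₂ : List (ERule n)} → ReductEquiv X₁ X₂ → ReductEquiv X₂ X₁
ReductEquiv-sym eq = reductEquiv (λ Φ I → ⇔.sym (sameAnswerSets eq Φ I))

cwv-transfer : {E Φ : List (Lit n)} {X₁ X₂ : List (ERule n)} {𝓜 : Worlds n} →
               ReductEquiv X₁ X₂ → CWV (elp E X₁) Φ 𝓜 → CWV (elp E X₂) Φ 𝓜
cwv-transfer {Φ = Φ} eq (Φ⊆E , 𝓜≡AS , compatible) =
  Φ⊆E , (λ I → ⇔.trans (𝓜≡AS I) (sameAnswerSets eq Φ I)) , compatible

-- Hence world views transfer: the guess stays a candidate guess, and it stays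
-- maximal because every rival candidate for X₂ is a rival candidate for X₁.
wv-transfer : {E : List (Lit n)} {X₁ X₂ : List (ERule n)} {𝓜 : Worlds n} →
              ReductEquiv X₁ X₂ → WV (elp E X₁) 𝓜 → WV (elp E X₂) 𝓜
wv-transfer eq (Φ , cwv , maximal) =
  Φ , cwv-transfer eq cwv ,
  λ Φ' 𝓜' cwv' → maximal Φ' 𝓜' (cwv-transfer (ReductEquiv-sym eq) cwv')

record Objective (X : List (ERule n)) (P : LP n) : Set where
  constructor objective
  field
    reduct≡ : ∀ (Φ : List (Lit n)) → ereduct Φ X ≡ P
open Objective

reduct-lift : (Φ : List (Lit n)) (R : LP n) → ereduct Φ (lift R) ≡ R
reduct-lift Φ R = begin
  ereduct Φ (lift R)        ≡⟨ cong (ereduct Φ) (sym (++-identityʳ (lift R))) ⟩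
  ereduct Φ (lift R ++ [])  ≡⟨ reduct-lift-++ Φ R [] ⟩
  R ++ []                   ≡⟨ ++-identityʳ R ⟩
  R                         ∎
  where open ≡-Reasoning

lift-++-objective : (R₁ R : LP n) → Objective (lift R₁ ++ lift R) (R₁ ++ R)
lift-++-objective R₁ R = objective λ Φ → begin
  ereduct Φ (lift R₁ ++ lift R)  ≡⟨ reduct-lift-++ Φ R₁ (lift R) ⟩
  R₁ ++ ereduct Φ (lift R)       ≡⟨ cong (R₁ ++_) (reduct-lift Φ R) ⟩
  R₁ ++ R                        ∎
  where open ≡-Reasoning

-- If P has an answer set, its answer sets form a world view of the objective
-- ELP (∅, X): the guess ∅ is compatible and, as ℰ = ∅, trivially maximal.
objective-worldView : {X : List (ERule n)} {P : LP n} {M : Subset n} →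
                      Objective X P → AnswerSet P M → WV (elp [] X) (AnswerSet P)
objective-worldView {X = X} {P} {M} obj asM =
  [] , ((λ ()) , answerSets≡ , ((M , asM) , (λ _ ()) , (λ _ ())))
     , (λ Φ' 𝓜' (Φ'⊆∅ , _) _ → Φ'⊆∅)
  where
  answerSets≡ : ∀ I → AnswerSet P I ⇔ AnswerSet (ereduct [] X) I
  answerSets≡ I = answerSets-≡ (sym (reduct≡ obj []))

objective-worldView-sound : {E : List (Lit n)} {X : List (ERule n)} {P : LP n}
                            {𝓜 : Worlds n} {I : Subset n} →
                            Objective X P → WV (elp E X) 𝓜 → 𝓜 I → AnswerSet P I
objective-worldView-sound {I = I} obj (Φ , (_ , 𝓜≡AS , _) , _) I∈𝓜 =
  Equivalence.to (⇔.trans (𝓜≡AS I) (answerSets-≡ (reduct≡ obj Φ))) I∈𝓜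

lp⇒reductEquiv : {R₁ R₂ : LP n} → StronglyEquivLP R₁ R₂ →
                 (X : List (ERule n)) → ReductEquiv (lift R₁ ++ X) (lift R₂ ++ X)
lp⇒reductEquiv {R₁ = R₁} {R₂} se X = reductEquiv λ Φ I →
  ⇔.trans (answerSets-≡ (reduct-lift-++ Φ R₁ X))
    (⇔.trans (se (ereduct Φ X) I) (answerSets-≡ (sym (reduct-lift-++ Φ R₂ X))))

-- Strong ELP equivalence transports answer sets of R₁ ++ R to R₂ ++ R,
-- through the world view formed by the answer sets of R₁ ++ R.
elp⇒answerSet : {R₁ R₂ : LP n} → StronglyEquivELP (toELP R₁) (toELP R₂) →
                (R : LP n) (M : Subset n) → AnswerSet (R₁ ++ R) M → AnswerSet (R₂ ++ R) M
elp⇒answerSet {R₁ = R₁} {R₂} se R M asM =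
  objective-worldView-sound (lift-++-objective R₂ R) wv₂ asM
  where
  wv₁ : WV (toELP R₁ ∪ᴱ toELP R) (AnswerSet (R₁ ++ R))
  wv₁ = objective-worldView (lift-++-objective R₁ R) asM
  wv₂ : WV (toELP R₂ ∪ᴱ toELP R) (AnswerSet (R₁ ++ R))
  wv₂ = Equivalence.to (se (toELP R) (lift-wellFormed R) (AnswerSet (R₁ ++ R))) wv₁

corollary2 : ∀ (n : ℕ) (R₁ R₂ : LP n) →
    StronglyEquivLP R₁ R₂ ⇔ StronglyEquivELP (toELP R₁) (toELP R₂)
corollary2 n R₁ R₂ = mk⇔ lp⇒elp elp⇒lp
  where
  lp⇒elp : StronglyEquivLP R₁ R₂ → StronglyEquivELP (toELP R₁) (toELP R₂)
  lp⇒elp se Π _ 𝓜 = mk⇔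
    (wv-transfer (lp⇒reductEquiv se (rules Π)))
    (wv-transfer (ReductEquiv-sym (lp⇒reductEquiv se (rules Π))))

  elp⇒lp : StronglyEquivELP (toELP R₁) (toELP R₂) → StronglyEquivLP R₁ R₂
  elp⇒lp se R M = mk⇔
    (elp⇒answerSet se R M)
    (elp⇒answerSet (λ Π wf 𝓜 → ⇔.sym (se Π wf 𝓜)) R M)
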